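{- There exist a constant $d$ and a polynomial $p$ such that for every non-bipartite finite simple graph $\mathcal{G}$ with vertex set $\{0,\dots,n-1\}$ and every bipartite finite simple graph $\mathcal{H}$ with vertex set $\{0,\dots,m-1\}$, the propositional tautology $\tau_{\mathcal{G},\mathcal{H}}$ (expressing that there is no homomorphism from $\mathcal{G}$ to $\mathcal{H}$) has a depth-$d$ Frege proof of size at most $p(n,m)$. That is, the family of tautologies $\tau_{\mathcal{G},\mathcal{H}}$ has polynomial size bounded depth Frege proofs.
   Context: Graphs are undirected, without loops. A homomorphism $\mathcal{G}\to\mathcal{H}$ is a map $h$ from vertices of $\mathcal{G}$ to vertices of $\mathcal{H}$ such that adjacent vertices are mapped to adjacent vertices. For $\mathcal{G}$ on $\{0,\dots,n-1\}$ and $\mathcal{H}$ on $\{0,\dots,m-1\}$, introduce propositional variables $p_{i,j}$ ($i<n$, $j<m$), meaning "vertex $i$ is mapped to vertex $j$". Then $\tau_{\mathcal{G},\mathcal{H}}$ is the formula $$\Big[\bigvee_{i<n}\bigwedge_{j<m}\neg p_{i,j}\Big]\vee\Big[\bigvee_{i<n}\bigvee_{j_1\neq j_2<m}(p_{i,j_1}\wedge p_{i,j_2})\Big]\vee\Big[\bigvee_{\substack{i_1,i_2<n\\ \{i_1,i_2\}\in E(\mathcal{G})}}\ \bigvee_{\substack{j_1,j_2<m\\ \{j_1,j_2\}\notin E(\mathcal{H})}}(p_{i_1,j_1}\wedge p_{i_2,j_2})\Big],$$ (the propositional translation of the statement that no set $Z$ codes a homomorphism from $\mathcal{G}$ to $\mathcal{H}$),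 which is a tautology whenever no homomorphism $\mathcal{G}\to\mathcal{H}$ exists. A depth-$d$ Frege proof is a proof in a (fixed) Frege propositional proof system in which all formulas have depth at most $d$ (constant-depth Frege). -}

module Defs where

open import Data.Nat using (ℕ; zero; suc; _+_; _⊔_; _≤_)
open import Data.Bool using (Bool; true; false; if_then_else_)
open import Data.Fin using (Fin; toℕ; _≟_)
open import Data.List using (List; []; _∷_; map; concatMap; allFin)
open import Data.List.Membership.Propositional using (_∈_)
open import Data.List.Relation.Binary.Subset.Propositional using (_⊆_)
open import Data.List.Relation.Unary.All using (All)
open import Data.Product using (_×_; _,_; Σ; ∃; ∃-syntax)
open import Data.Unit using (⊤)
open import Relation.Nullary using (¬_; yes; no)
open import Relation.Nullary.Decidable using (⌊_⌋)
open import Relation.Binary.PropositionalEquality using (_≡_; _≢_)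

record Graph (n : ℕ) : Set where
  field
    adj       : Fin n → Fin n → Bool
    symmetric : ∀ i j → adj i j ≡ adj j i
    loopless  : ∀ i → adj i i ≡ false
open Graph public

Bipartite : ∀ {n} → Graph n → Set
Bipartite {n} G = Σ (Fin n → Bool) (λ c → ∀ (i j : Fin n) → adj G i j ≡ true → c i ≢ c j)


-- Constant-depth propositional formulas (unbounded fan-in ∧/∨,
-- negation pushed to the variables).  Variables are p_{i,j}, (i , j) : ℕ × ℕ.

Var : Set
Var = ℕ × ℕ

data Form : Set where
  pos : Var → Form
  neg : Var → Form
  ⋀   : List Form → Form
  ⋁   : List Form → Form

-- negation of a formula (De Morgan dual)
mutual
  dual : Form → Form
  dual (pos x) = neg x
  dual (neg x) = pos x
  dual (⋀ As)  = ⋁ (duals As)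
  dual (⋁ As)  = ⋀ (duals As)

  duals : List Form → List Form
  duals []       = []
  duals (A ∷ As) = dual A ∷ duals As

mutual
  size : Form → ℕ
  size (pos _) = 1
  size (neg _) = 1
  size (⋀ As)  = suc (sizes As)
  size (⋁ As)  = suc (sizes As)

  sizes : List Form → ℕ
  sizes []       = 0
  sizes (A ∷ As) = size A + sizes As

mutual
  depth : Form → ℕ
  depth (pos _) = 0
  depth (neg _) = 0
  depth (⋀ As)  = suc (depths As)
  depth (⋁ As)  = suc (depths As)

  depths : List Form → ℕ
  depths []       = 0
  depths (A ∷ As) = depth A ⊔ depths As

-- The fixed Frege-style proof system: the one-sided (Tait) sequent calculus
-- with unbounded fan-in connectives and cut.  A sequent is a list of formulas,
-- read as their disjunction.  A proof is a sequence of lines (sequents), each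
-- derived from earlier lines (dag-like, i.e. Frege-style, proofs).

Sequent : Set
Sequent = List Form

data Justified (prev : List Sequent) : Sequent → Set where
  axiom  : ∀ {Δ} x → pos x ∈ Δ → neg x ∈ Δ → Justified prev Δ
  weak   : ∀ {Γ Δ} → Γ ∈ prev → Γ ⊆ Δ → Justified prev Δ
  andI   : ∀ {Γ} As → All (λ A → (A ∷ Γ) ∈ prev) As → Justified prev (⋀ As ∷ Γ)
  orI    : ∀ {Γ A} As → A ∈ As → (A ∷ Γ) ∈ prev → Justified prev (⋁ As ∷ Γ)
  cut    : ∀ {Δ} A → (A ∷ Δ) ∈ prev → (dual A ∷ Δ) ∈ prev → Justified prev Δ

-- proofs are listed with the LAST line first
ValidProof : List Sequent → Set
ValidProof []         = ⊤
ValidProof (Δ ∷ prev) = Justified prev Δ × ValidProof prev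

data Proves : List Sequent → Form → Set where
  proves : ∀ {A} prev → Proves ((A ∷ []) ∷ prev) A

sizeSeq : Sequent → ℕ
sizeSeq = sizes

depthSeq : Sequent → ℕ
depthSeq = depths

proofSize : List Sequent → ℕ
proofSize []       = 0
proofSize (Δ ∷ π) = sizeSeq Δ + proofSize π

proofDepth : List Sequent → ℕ
proofDepth []       = 0
proofDepth (Δ ∷ π) = depthSeq Δ ⊔ proofDepth π

ProofOf : Form → ℕ → ℕ → Set
ProofOf A d s = ∃[ π ] (ValidProof π × Proves π A × proofDepth π ≤ d × proofSize π ≤ s)

p : ∀ {n m} → Fin n → Fin m → Var
p i j = (toℕ i , toℕ j)

_∧₂_ : Form → Form → Form
A ∧₂ B = ⋀ (A ∷ B ∷ [])

τ : ∀ {n m} → Graph n → Graph m → Form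
τ {n} {m} G H = ⋁ (part₁ ∷ part₂ ∷ part₃ ∷ [])
  where
  part₁ = ⋁ (map (λ i → ⋀ (map (λ j → neg (p i j)) (allFin m))) (allFin n))
  part₂ = ⋁ (concatMap (λ i → concatMap (λ j₁ → concatMap (λ j₂ →
            if ⌊ j₁ ≟ j₂ ⌋
            then [] else (pos (p i j₁) ∧₂ pos (p i j₂) ∷ []))
            (allFin m)) (allFin m)) (allFin n))
  part₃ = ⋁ (concatMap (λ i₁ → concatMap (λ i₂ → concatMap (λ j₁ → concatMap (λ j₂ →
            if adj G i₁ i₂
            then (if adj H j₁ j₂ then [] else (pos (p i₁ j₁) ∧₂ pos (p i₂ j₂) ∷ []))
            else [])
            (allFin m)) (allFin m)) (allFin n)) (allFin n))

module Submission where

-- Let G be non-bipartite and H bipartite with a proper 2-colouring cH.  Write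
-- Into v c for the disjunction of the variables p_{v,j} with cH j = c ("v is mapped
-- into colour class c").  Modulo τ = τ_{G,H}, every vertex is mapped into some class
-- ('somewhere'), not into both ('notBoth'), and an edge never has both ends in the
-- same class ('edgeSplits'); these are derived from the three parts of τ.  Hence,
-- walking along an odd closed walk from i back to i, cuts propagate Into i s to
-- Into i (not s) ('Propagation'), and finitely many further cuts derive τ.
--
-- The construction uses only
-- lines of at most five formulas of depth ≤ 3 and size ≤ N^10, and at most N^22
-- lines, giving a depth-3 proof of size at most N^35.

open import Defs
open import Data.Nat using (ℕ; zero; suc; _+_; _*_; _^_; _⊔_; _≤_; z≤n; s≤s; _≤?_; >-nonZero)
open import Data.Nat.Properties using (≤-refl; ≤-trans; ≤-reflexive; n≤1+n; m≤m+n; m≤n+m; +-assoc; +-identityʳ; +-mono-≤; *-assoc; *-identityʳ; *-distribʳ-+; *-mono-≤; *-monoˡ-≤; *-monoʳ-≤; ^-monoˡ-≤; ^-monoʳ-≤; ^-distribˡ-+-*; ⊔-lub; m⊔n≤o⇒m≤o; m⊔n≤o⇒n≤o; module ≤-Reasoning)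
open import Data.Nat.Tactic.RingSolver using (solve-∀)
open import Data.Bool using (Bool; true; false; not; if_then_else_; _xor_)
import Data.Bool as Bool
open import Data.Bool.Properties using (not-involutive; not-distribˡ-xor)
open import Data.Fin using (Fin; zero; suc; _≟_)
open import Data.Fin.Properties using (any?)
open import Data.List using (List; []; _∷_; length; map; allFin; concatMap; _++_)
open import Data.List.Properties using (length-map; length-++; length-tabulate)
open import Data.List.Membership.Propositional using (_∈_; lose)
open import Data.List.Membership.Propositional.Properties using (∈-allFin; ∈-map⁺; ∈-++⁺ˡ; ∈-++⁺ʳ; ∈-concatMap⁺)
import Data.List.Membership.DecPropositional as DecMembership
open import Data.List.Relation.Unary.Any using (here; there)
open import Data.List.Relation.Unary.All using (All; []; _∷_)
import Data.List.Relation.Unary.All as All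
open import Data.List.Relation.Unary.All.Properties using (¬Any⇒All¬; map⁺; tabulate⁺)
open import Data.List.Relation.Unary.AllPairs using ([]; _∷_)
open import Data.List.Relation.Unary.Unique.Propositional using (Unique)
open import Data.Maybe using (Maybe; just; nothing)
import Data.Maybe as Maybe
open import Data.Maybe.Properties using (just-injective)
open import Data.Product using (Σ; ∃; ∃-syntax; _×_; _,_; proj₁; proj₂)
open import Data.Product.Properties using (≡-dec)
open import Data.Sum using (_⊎_; inj₁; inj₂)
open import Data.Unit using (tt)
open import Data.Empty using (⊥-elim)
open import Relation.Nullary using (¬_; Dec; yes; no)
open import Relation.Nullary.Decidable using (isYes; _×-dec_; ⌊_⌋; True; toWitness)
open import Relation.Binary.PropositionalEquality using (_≡_; _≢_; refl; sym; trans; cong; cong₂; subst; module ≡-Reasoning)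
open import Relation.Binary.Definitions using (DecidableEquality)

remove : ∀ {A : Set} {x : A} (ys : List A) → x ∈ ys → List A
remove (y ∷ ys) (here _)     = ys
remove (y ∷ ys) (there x∈ys) = y ∷ remove ys x∈ys

length-remove : ∀ {A : Set} {x : A} (ys : List A) (x∈ys : x ∈ ys) →
                length ys ≡ suc (length (remove ys x∈ys))
length-remove (y ∷ ys) (here _)     = refl
length-remove (y ∷ ys) (there x∈ys) = cong suc (length-remove ys x∈ys)

∈-remove : ∀ {A : Set} {x y : A} (ys : List A) (x∈ys : x ∈ ys) → y ∈ ys → y ≢ x → y ∈ remove ys x∈ys
∈-remove (z ∷ zs) (here refl)  (here refl)  y≢x = ⊥-elim (y≢x refl)
∈-remove (z ∷ zs) (here refl)  (there y∈zs) y≢x = y∈zs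
∈-remove (z ∷ zs) (there x∈zs) (here refl)  y≢x = here refl
∈-remove (z ∷ zs) (there x∈zs) (there y∈zs) y≢x = there (∈-remove zs x∈zs y∈zs y≢x)

unique⇒length≤ : ∀ {A : Set} {xs ys : List A} → Unique xs → (∀ {y} → y ∈ xs → y ∈ ys) →
                 length xs ≤ length ys
unique⇒length≤ [] _ = z≤n
unique⇒length≤ {xs = x ∷ xs} {ys} (x∉xs ∷ uxs) xs⊆ys =
  subst (suc (length xs) ≤_) (sym (length-remove ys x∈ys))
    (s≤s (unique⇒length≤ uxs (λ y∈xs →
      ∈-remove ys x∈ys (xs⊆ys (there y∈xs)) (λ y≡x → All.lookup x∉xs y∈xs (sym y≡x)))))
  where x∈ys = xs⊆ys (here refl)

∈-concatMap : ∀ {A B : Set} (f : A → List B) {x : B} {a : A} {xs : List A} →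
              x ∈ f a → a ∈ xs → x ∈ concatMap f xs
∈-concatMap f x∈fa a∈xs = ∈-concatMap⁺ f (lose a∈xs x∈fa)

length-allFin : ∀ k → length (allFin k) ≡ k
length-allFin k = length-tabulate {n = k} (λ i → i)

-- Its only property that matters is that it depends on the predicate alone,
-- not on the way it is decided ('first-cong').
first : ∀ {k} {P : Fin k → Set} → (∀ i → Dec (P i)) → Maybe (Fin k)
first {zero}  P? = nothing
first {suc k} P? with P? zero
... | yes _ = just zero
... | no  _ = Maybe.map suc (first (λ i → P? (suc i)))

first-cong : ∀ {k} {P Q : Fin k → Set} (P? : ∀ i → Dec (P i)) (Q? : ∀ i → Dec (Q i)) →
             (∀ i → P i → Q i) → (∀ i → Q i → P i) → first P? ≡ first Q?
first-cong {zero}  P? Q? P⇒Q Q⇒P = refl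
first-cong {suc k} P? Q? P⇒Q Q⇒P with P? zero | Q? zero
... | yes _  | yes _  = refl
... | yes P0 | no ¬Q0 = ⊥-elim (¬Q0 (P⇒Q zero P0))
... | no ¬P0 | yes Q0 = ⊥-elim (¬P0 (Q⇒P zero Q0))
... | no _   | no _   = cong (Maybe.map suc)
  (first-cong (λ i → P? (suc i)) (λ i → Q? (suc i)) (λ i → P⇒Q (suc i)) (λ i → Q⇒P (suc i)))

first-sound : ∀ {k} {P : Fin k → Set} (P? : ∀ i → Dec (P i)) {i} → first P? ≡ just i → P i
first-sound {zero}  P? ()
first-sound {suc k} P? eq with P? zero
first-sound {suc k} P? refl | yes P0 = P0
... | no _ with first (λ i → P? (suc i)) in e
first-sound {suc k} P? refl | no _ | just j = first-sound (λ i → P? (suc i)) e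

first-complete : ∀ {k} {P : Fin k → Set} (P? : ∀ i → Dec (P i)) {i} → P i →
                 Σ (Fin k) (λ j → first P? ≡ just j)
first-complete {suc k} P? {i} Pi with P? zero
... | yes _ = zero , refl
first-complete {suc k} P? {zero}  Pi | no ¬P0 = ⊥-elim (¬P0 Pi)
first-complete {suc k} P? {suc i} Pi | no ¬P0 with first-complete (λ i → P? (suc i)) Pi
... | j , e = suc j , cong (Maybe.map suc) e

-- Walks are taken in the bipartite double cover of G, whose nodes are vertices
-- tagged with a parity bit; an odd closed walk at i is a walk from (i , false) to (i , true).
module OddWalks {n : ℕ} (G : Graph n) where

  Node : Set
  Node = Fin n × Bool

  Step : Node → Node → Set
  Step (v , b) (w , c) = adj G v w ≡ true × c ≡ not b

  data Walk : Node → Node → Set where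
    stop : ∀ {x} → Walk x x
    step : ∀ {x y z} → Step x y → Walk y z → Walk x z

  len : ∀ {x y} → Walk x y → ℕ
  len stop       = 0
  len (step _ w) = suc (len w)

  _++ʷ_ : ∀ {x y z} → Walk x y → Walk y z → Walk x z
  stop       ++ʷ w′ = w′
  step s w   ++ʷ w′ = step s (w ++ʷ w′)

  reverse : ∀ {x y} → Walk x y → Walk y x
  reverse stop                      = stop
  reverse (step {x = v , b} (e , refl) w) =
    reverse w ++ʷ step (trans (symmetric G _ v) e , sym (not-involutive b)) stop

  toggle : Node → Node
  toggle (v , b) = v , not b

  toggleʷ : ∀ {x y} → Walk x y → Walk (toggle x) (toggle y)
  toggleʷ stop              = stop
  toggleʷ (step (e , eq) w) = step (e , cong not eq) (toggleʷ w)

  nodes : ∀ {x y} → Walk x y → List Node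
  nodes {x} stop       = x ∷ []
  nodes {x} (step _ w) = x ∷ nodes w

  length-nodes : ∀ {x y} (w : Walk x y) → length (nodes w) ≡ suc (len w)
  length-nodes stop       = refl
  length-nodes (step _ w) = cong suc (length-nodes w)

  _≟ᴺ_ : DecidableEquality Node
  _≟ᴺ_ = ≡-dec _≟_ Bool._≟_

  allNodes : List Node
  allNodes = map (_, false) (allFin n) ++ map (_, true) (allFin n)

  length-allNodes : length allNodes ≡ n + n
  length-allNodes = trans (length-++ (map (_, false) (allFin n)))
    (cong₂ _+_ (trans (length-map _ (allFin n)) (length-allFin n))
               (trans (length-map _ (allFin n)) (length-allFin n)))

  ∈-allNodes : ∀ x → x ∈ allNodes
  ∈-allNodes (v , false) = ∈-++⁺ˡ (∈-map⁺ (_, false) (∈-allFin v))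
  ∈-allNodes (v , true)  = ∈-++⁺ʳ (map (_, false) (allFin n)) (∈-map⁺ (_, true) (∈-allFin v))

  SimpleWalk : Node → Node → Set
  SimpleWalk x y = Σ (Walk x y) (λ w → Unique (nodes w))

  suffix : ∀ {x y z} (w : Walk y z) → x ∈ nodes w → Unique (nodes w) → SimpleWalk x z
  suffix stop       (here refl) u       = stop , u
  suffix (step s w) (here refl) u       = step s w , u
  suffix (step s w) (there x∈w) (_ ∷ u) = suffix w x∈w u

  simplify : ∀ {x y} → Walk x y → SimpleWalk x y
  simplify stop = stop , ([] ∷ [])
  simplify {x} (step s w) with simplify w
  ... | w′ , u with DecMembership._∈?_ _≟ᴺ_ x (nodes w′)
  ...   | yes x∈w′ = suffix w′ x∈w′ u
  ...   | no  x∉w′ = step s w′ , (¬Any⇒All¬ _ x∉w′ ∷ u)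

  WalkWithin : Node → Node → ℕ → Set
  WalkWithin x y l = Σ (Walk x y) (λ w → len w ≤ l)

  Short : Node → Node → Set
  Short x y = WalkWithin x y (n + n)

  -- every walk can be shortened to length at most 2n: a simple walk has at most 2n nodes
  shorten : ∀ {x y} → Walk x y → Short x y
  shorten w with simplify w
  ... | w′ , u = w′ , ≤-trans (n≤1+n _)
    (subst (_≤ n + n) (length-nodes w′)
      (subst (length (nodes w′) ≤_) length-allNodes
        (unique⇒length≤ u (λ {x} _ → ∈-allNodes x))))

  Step? : ∀ x y → Dec (Step x y)
  Step? (v , b) (w , c) = (adj G v w Bool.≟ true) ×-dec (c Bool.≟ not b)

  anyNode? : {P : Node → Set} → (∀ x → Dec (P x)) → Dec (∃ P)
  anyNode? P? with any? (λ v → P? (v , false)) | any? (λ v → P? (v , true))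
  ... | yes (v , Pv) | _            = yes (_ , Pv)
  ... | no _         | yes (v , Pv) = yes (_ , Pv)
  ... | no ¬F        | no ¬T        =
    no λ { ((v , false) , Pv) → ¬F (v , Pv) ; ((v , true) , Pv) → ¬T (v , Pv) }

  walkWithin? : ∀ x y l → Dec (WalkWithin x y l)
  walkWithin? x y l with x ≟ᴺ y
  ... | yes refl = yes (stop , z≤n)
  walkWithin? x y zero    | no x≢y = no λ { (stop , _) → x≢y refl ; (step _ _ , ()) }
  walkWithin? x y (suc l) | no x≢y with anyNode? (λ z → Step? x z ×-dec walkWithin? z y l)
  ... | yes (z , s , w , w≤l) = yes (step s w , s≤s w≤l)
  ... | no ¬∃z = no λ { (stop , _) → x≢y refl ; (step s w , s≤s w≤l) → ¬∃z (_ , s , w , w≤l) }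

  Reaches : Fin n → Fin n → Set
  Reaches j i = Σ Bool (λ b → Short (i , false) (j , b))

  reaches? : ∀ j i → Dec (Reaches j i)
  reaches? j i with walkWithin? (i , false) (j , false) (n + n) | walkWithin? (i , false) (j , true) (n + n)
  ... | yes w | _     = yes (false , w)
  ... | no _  | yes w = yes (true , w)
  ... | no ¬F | no ¬T = no λ { (false , w) → ¬F w ; (true , w) → ¬T w }

  reaches-edge : ∀ {j k i} → adj G j k ≡ true → Reaches j i → Reaches k i
  reaches-edge e (b , w , _) = not b , shorten (w ++ʷ step (e , refl) stop)

  rootOf : ∀ j → Σ (Fin n) (λ r → first (reaches? j) ≡ just r)
  rootOf j = first-complete (reaches? j) {j} (false , stop , z≤n)

  root : Fin n → Fin n
  root j = proj₁ (rootOf j)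

  reaches-root : ∀ j → Reaches j (root j)
  reaches-root j = first-sound (reaches? j) (proj₂ (rootOf j))

  -- adjacent vertices have the same root, as their components coincide
  root-edge : ∀ {j k} → adj G j k ≡ true → root j ≡ root k
  root-edge {j} {k} e = just-injective (begin
    just (root j)      ≡⟨ proj₂ (rootOf j) ⟨
    first (reaches? j) ≡⟨ first-cong (reaches? j) (reaches? k) (λ _ → reaches-edge e)
                                     (λ _ → reaches-edge (trans (symmetric G k j) e)) ⟩
    first (reaches? k) ≡⟨ proj₂ (rootOf k) ⟩
    just (root k)      ∎)
    where open ≡-Reasoning

  OddClosedWalk : Fin n → Set
  OddClosedWalk i = Short (i , false) (i , true)

  -- Without short odd closed walks, colouring each vertex by the parity of its
  -- distance from the root of its component is proper.
  module Colouring (noOdd : ∀ i → ¬ OddClosedWalk i) where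

    colour : Fin n → Bool
    colour j = isYes (walkWithin? (root j , false) (j , true) (n + n))

    parity-differs : ∀ r j k → adj G j k ≡ true → Reaches j r →
      (dj : Dec (Short (r , false) (j , true))) → (dk : Dec (Short (r , false) (k , true))) →
      isYes dj ≢ isYes dk
    parity-differs r j k e _ (yes (wj , _)) (yes (wk , _)) _ =
      noOdd r (shorten (wk ++ʷ toggleʷ (reverse (wj ++ʷ step {y = k , false} (e , refl) stop))))
    parity-differs r j k e (true  , wj) (no ¬wj) (no _) _ = ¬wj wj
    parity-differs r j k e (false , (wj , _)) (no _) (no ¬wk) _ =
      ¬wk (shorten (wj ++ʷ step {y = k , true} (e , refl) stop))
    parity-differs r j k e _ (yes _) (no _) ()
    parity-differs r j k e _ (no _) (yes _) ()

    proper : ∀ j k → adj G j k ≡ true → colour j ≢ colour k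
    proper j k e with root k | root-edge {j} {k} e
    ... | .(root j) | refl = parity-differs (root j) j k e (reaches-root j) _ _

  oddClosedWalk : ¬ Bipartite G → Σ (Fin n) OddClosedWalk
  oddClosedWalk ¬bip with any? (λ i → walkWithin? (i , false) (i , true) (n + n))
  ... | yes odd = odd
  ... | no ¬odd = ⊥-elim (¬bip (colour , proper))
    where open Colouring (λ i w → ¬odd (i , w))

justified-mono : ∀ {prev prev′ Δ} → (∀ {Γ} → Γ ∈ prev → Γ ∈ prev′) → Justified prev Δ → Justified prev′ Δ
justified-mono f (axiom x pos∈ neg∈) = axiom x pos∈ neg∈
justified-mono f (weak Γ∈ Γ⊆Δ)       = weak (f Γ∈) Γ⊆Δ
justified-mono f (andI As prems)     = andI As (All.map f prems)
justified-mono f (orI As A∈ prem)    = orI As A∈ (f prem)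
justified-mono f (cut A prem₁ prem₂) = cut A (f prem₁) (f prem₂)

valid-++ : ∀ π₁ {π₂} → ValidProof π₁ → ValidProof π₂ → ValidProof (π₁ ++ π₂)
valid-++ []       v₁        v₂ = v₂
valid-++ (Δ ∷ π₁) (j , v₁) v₂ = justified-mono ∈-++⁺ˡ j , valid-++ π₁ v₁ v₂

proofSize-++ : ∀ π₁ {π₂} → proofSize (π₁ ++ π₂) ≡ proofSize π₁ + proofSize π₂
proofSize-++ []       = refl
proofSize-++ (Δ ∷ π₁) = trans (cong (sizeSeq Δ +_) (proofSize-++ π₁)) (sym (+-assoc (sizeSeq Δ) _ _))

proofDepth-++ : ∀ π₁ {π₂ d} → proofDepth π₁ ≤ d → proofDepth π₂ ≤ d → proofDepth (π₁ ++ π₂) ≤ d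
proofDepth-++ []       _   h₂ = h₂
proofDepth-++ (Δ ∷ π₁) h₁ h₂ = ⊔-lub (m⊔n≤o⇒m≤o _ _ h₁) (proofDepth-++ π₁ (m⊔n≤o⇒n≤o _ _ h₁) h₂)

-- Proofs of depth at most d whose lines are sequents of size at most W, built
-- bottom-up rule by rule.  'Deriv k Δ' is such a proof of Δ of size at most k * W,
-- so k bounds its number of lines; each rule adds one line to its premises' proofs.
module Derivations (d W : ℕ) where

  Line : Sequent → Set
  Line Δ = sizeSeq Δ ≤ W × depthSeq Δ ≤ d

  record Deriv (k : ℕ) (Δ : Sequent) : Set where
    constructor deriv
    field
      earlier : List Sequent
      valid   : ValidProof (Δ ∷ earlier)
      depth≤  : proofDepth (Δ ∷ earlier) ≤ d
      size≤   : proofSize (Δ ∷ earlier) ≤ k * W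

  relax : ∀ {k k′ Δ} → k ≤ k′ → Deriv k Δ → Deriv k′ Δ
  relax k≤k′ (deriv π v dπ sπ) = deriv π v dπ (≤-trans sπ (*-monoˡ-≤ W k≤k′))

  rule₀ : ∀ {Δ} → Line Δ → Justified [] Δ → Deriv 1 Δ
  rule₀ (sΔ , dΔ) j = deriv [] (j , tt) (⊔-lub dΔ z≤n) (+-mono-≤ sΔ z≤n)

  rule₁ : ∀ {k Γ Δ} → Line Δ → Deriv k Γ → (∀ {prev} → Γ ∈ prev → Justified prev Δ) → Deriv (suc k) Δ
  rule₁ {Γ = Γ} (sΔ , dΔ) (deriv π v dπ sπ) j = deriv (Γ ∷ π) (j (here refl) , v) (⊔-lub dΔ dπ) (+-mono-≤ sΔ sπ)

  rule₂ : ∀ {k₁ k₂ Γ₁ Γ₂ Δ} → Line Δ → Deriv k₁ Γ₁ → Deriv k₂ Γ₂ →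
          (∀ {prev} → Γ₁ ∈ prev → Γ₂ ∈ prev → Justified prev Δ) → Deriv (suc (k₁ + k₂)) Δ
  rule₂ {k₁} {k₂} {Γ₁} {Γ₂} (sΔ , dΔ) (deriv π₁ v₁ d₁ s₁) (deriv π₂ v₂ d₂ s₂) j =
    deriv ((Γ₁ ∷ π₁) ++ (Γ₂ ∷ π₂))
      (j (here refl) (∈-++⁺ʳ (Γ₁ ∷ π₁) (here refl)) , valid-++ (Γ₁ ∷ π₁) v₁ v₂)
      (⊔-lub dΔ (proofDepth-++ (Γ₁ ∷ π₁) d₁ d₂))
      (+-mono-≤ sΔ (begin
        proofSize ((Γ₁ ∷ π₁) ++ (Γ₂ ∷ π₂))           ≡⟨ proofSize-++ (Γ₁ ∷ π₁) ⟩
        proofSize (Γ₁ ∷ π₁) + proofSize (Γ₂ ∷ π₂)    ≤⟨ +-mono-≤ s₁ s₂ ⟩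
        k₁ * W + k₂ * W                                ≡⟨ *-distribʳ-+ W k₁ k₂ ⟨
        (k₁ + k₂) * W                                  ∎))
    where open ≤-Reasoning

  private
    stack : ∀ {k Γ} {As : List Form} → All (λ A → Deriv k (A ∷ Γ)) As →
            Σ (List Sequent) (λ π → ValidProof π × All (λ A → (A ∷ Γ) ∈ π) As ×
                                    proofDepth π ≤ d × proofSize π ≤ length As * (k * W))
    stack [] = [] , tt , [] , z≤n , z≤n
    stack {Γ = Γ} {A ∷ As} (deriv π v dπ sπ ∷ ds) with stack ds
    ... | ρ , vρ , ∈ρ , dρ , sρ =
      ((A ∷ Γ) ∷ π) ++ ρ , valid-++ ((A ∷ Γ) ∷ π) v vρ ,
      here refl ∷ All.map (∈-++⁺ʳ ((A ∷ Γ) ∷ π)) ∈ρ ,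
      proofDepth-++ ((A ∷ Γ) ∷ π) dπ dρ ,
      ≤-trans (≤-reflexive (proofSize-++ ((A ∷ Γ) ∷ π))) (+-mono-≤ sπ sρ)

  ruleAnd : ∀ {k Γ} (As : List Form) → Line (⋀ As ∷ Γ) → All (λ A → Deriv k (A ∷ Γ)) As →
            Deriv (suc (length As * k)) (⋀ As ∷ Γ)
  ruleAnd {k} As (sΔ , dΔ) ds with stack ds
  ... | π , vπ , ∈π , dπ , sπ =
    deriv π (andI As ∈π , vπ) (⊔-lub dΔ dπ)
      (+-mono-≤ sΔ (≤-trans sπ (≤-reflexive (sym (*-assoc (length As) k W)))))

  toProof : ∀ {k s A} → Deriv k (A ∷ []) → k * W ≤ s → ProofOf A d s
  toProof (deriv π v dπ sπ) k*W≤s = (_ ∷ π) , v , proves π , dπ , ≤-trans sπ k*W≤s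

sizes-++ : ∀ As {Bs} → sizes (As ++ Bs) ≡ sizes As + sizes Bs
sizes-++ []       = refl
sizes-++ (A ∷ As) = trans (cong (size A +_) (sizes-++ As)) (sym (+-assoc (size A) _ _))

depths-++ : ∀ As {Bs d} → depths As ≤ d → depths Bs ≤ d → depths (As ++ Bs) ≤ d
depths-++ []       _  h₂ = h₂
depths-++ (A ∷ As) h₁ h₂ = ⊔-lub (m⊔n≤o⇒m≤o _ _ h₁) (depths-++ As (m⊔n≤o⇒n≤o _ _ h₁) h₂)

module _ {X : Set} where

  sizes-map : ∀ (f : X → Form) {b} → (∀ x → size (f x) ≤ b) → ∀ xs → sizes (map f xs) ≤ length xs * b
  sizes-map f h []       = z≤n
  sizes-map f h (x ∷ xs) = +-mono-≤ (h x) (sizes-map f h xs)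

  depths-map : ∀ (f : X → Form) {d} → (∀ x → depth (f x) ≤ d) → ∀ xs → depths (map f xs) ≤ d
  depths-map f h []       = z≤n
  depths-map f h (x ∷ xs) = ⊔-lub (h x) (depths-map f h xs)

  sizes-concatMap : ∀ (f : X → List Form) {b} → (∀ x → sizes (f x) ≤ b) → ∀ xs →
                    sizes (concatMap f xs) ≤ length xs * b
  sizes-concatMap f h []       = z≤n
  sizes-concatMap f h (x ∷ xs) = ≤-trans (≤-reflexive (sizes-++ (f x))) (+-mono-≤ (h x) (sizes-concatMap f h xs))

  depths-concatMap : ∀ (f : X → List Form) {d} → (∀ x → depths (f x) ≤ d) → ∀ xs → depths (concatMap f xs) ≤ d
  depths-concatMap f h []       = z≤n
  depths-concatMap f h (x ∷ xs) = depths-++ (f x) (h x) (depths-concatMap f h xs)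

  duals-map : ∀ (f : X → Form) xs → duals (map f xs) ≡ map (λ x → dual (f x)) xs
  duals-map f []       = refl
  duals-map f (x ∷ xs) = cong (dual (f x) ∷_) (duals-map f xs)

mutual
  size-dual : ∀ A → size (dual A) ≡ size A
  size-dual (pos x) = refl
  size-dual (neg x) = refl
  size-dual (⋀ As)  = cong suc (sizes-duals As)
  size-dual (⋁ As)  = cong suc (sizes-duals As)

  sizes-duals : ∀ As → sizes (duals As) ≡ sizes As
  sizes-duals []       = refl
  sizes-duals (A ∷ As) = cong₂ _+_ (size-dual A) (sizes-duals As)

mutual
  depth-dual : ∀ A → depth (dual A) ≡ depth A
  depth-dual (pos x) = refl
  depth-dual (neg x) = refl
  depth-dual (⋀ As)  = cong suc (depths-duals As)
  depth-dual (⋁ As)  = cong suc (depths-duals As)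

  depths-duals : ∀ As → depths (duals As) ≡ depths As
  depths-duals []       = refl
  depths-duals (A ∷ As) = cong₂ _⊔_ (depth-dual A) (depths-duals As)

-- Bookkeeping with powers of a fixed base N ≥ 2.  'pw' is kept opaque so that the
-- exponents stay symbolic during type checking.
module Powers (N : ℕ) (2≤N : 2 ≤ N) where

  opaque
    pw : ℕ → ℕ
    pw e = N ^ e

    pw-≡ : ∀ e → pw e ≡ N ^ e
    pw-≡ e = refl

    ≤pw : ∀ {a} e → a ≤ 2 ^ e → a ≤ pw e
    ≤pw e a≤ = ≤-trans a≤ (^-monoˡ-≤ e 2≤N)

    pw-mono : ∀ {e e′} → e ≤ e′ → pw e ≤ pw e′
    pw-mono = ^-monoʳ-≤ N {{>-nonZero (≤-trans (s≤s z≤n) 2≤N)}}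

    +-≤pw : ∀ {a b e} → a ≤ pw e → b ≤ pw e → a + b ≤ pw (suc e)
    +-≤pw {e = e} a≤ b≤ = ≤-trans (+-mono-≤ a≤ b≤)
      (≤-trans (≤-reflexive (cong (N ^ e +_) (sym (+-identityʳ (N ^ e))))) (*-monoˡ-≤ (N ^ e) 2≤N))

    *-≤pw : ∀ {a b e f} → a ≤ pw e → b ≤ pw f → a * b ≤ pw (e + f)
    *-≤pw {e = e} {f} a≤ b≤ = ≤-trans (*-mono-≤ a≤ b≤) (≤-reflexive (sym (^-distribˡ-+-* N e f)))

    N≤pw1 : N ≤ pw 1
    N≤pw1 = ≤-reflexive (sym (*-identityʳ N))

  1≤pw : ∀ e → 1 ≤ pw e
  1≤pw e = ≤pw e (^-monoʳ-≤ 2 {0} {e} z≤n)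

  ≤pw-mono : ∀ {a e e′} → e ≤ e′ → a ≤ pw e → a ≤ pw e′
  ≤pw-mono e≤e′ a≤ = ≤-trans a≤ (pw-mono e≤e′)

  suc-≤pw : ∀ {a e} → a ≤ pw e → suc a ≤ pw (suc e)
  suc-≤pw {e = e} a≤ = +-≤pw {e = e} (1≤pw e) a≤

  *N-≤pw : ∀ {a b e} → a ≤ N → b ≤ pw e → a * b ≤ pw (suc e)
  *N-≤pw a≤ b≤ = *-≤pw {e = 1} (≤-trans a≤ N≤pw1) b≤

  suc-*-≤pw : ∀ {a b e} → suc a ≤ N → b ≤ pw e → suc (a * b) ≤ pw (suc e)
  suc-*-≤pw {a} {b} {e} sa≤N b≤ = ≤-trans (+-mono-≤ (1≤pw e) (*-monoʳ-≤ a b≤))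
    (*-≤pw {e = 1} (≤-trans sa≤N N≤pw1) ≤-refl)

nowhereAt : ∀ {n} m → Fin n → Form
nowhereAt m i = ⋀ (map (λ j → neg (p i j)) (allFin m))

nowhere : ∀ n m → List Form
nowhere n m = map (nowhereAt m) (allFin n)

twiceAt : ∀ {n m} → Fin n → Fin m → Fin m → List Form
twiceAt i j₁ j₂ = if ⌊ j₁ ≟ j₂ ⌋ then [] else (pos (p i j₁) ∧₂ pos (p i j₂) ∷ [])

twiceFrom : ∀ {n} m → Fin n → Fin m → List Form
twiceFrom m i j₁ = concatMap (twiceAt i j₁) (allFin m)

twiceOf : ∀ {n} m → Fin n → List Form
twiceOf m i = concatMap (twiceFrom m i) (allFin m)

twice : ∀ n m → List Form
twice n m = concatMap (twiceOf m) (allFin n)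

∈-twice : ∀ {n m} (i : Fin n) (j₁ j₂ : Fin m) → j₁ ≢ j₂ → (pos (p i j₁) ∧₂ pos (p i j₂)) ∈ twice n m
∈-twice {n} {m} i j₁ j₂ j₁≢j₂ = ∈-concatMap (twiceOf {n} m) (∈-concatMap (twiceFrom m i)
  (∈-concatMap (twiceAt i j₁) here′ (∈-allFin j₂)) (∈-allFin j₁)) (∈-allFin i)
  where
  here′ : (pos (p i j₁) ∧₂ pos (p i j₂)) ∈ twiceAt i j₁ j₂
  here′ with j₁ ≟ j₂
  ... | yes j₁≡j₂ = ⊥-elim (j₁≢j₂ j₁≡j₂)
  ... | no  _     = here refl

PairOrEmpty : List Form → Set
PairOrEmpty L = L ≡ [] ⊎ Σ Var (λ x → Σ Var (λ y → L ≡ (pos x ∧₂ pos y ∷ [])))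

twiceAt-pairOrEmpty : ∀ {n m} (i : Fin n) (j₁ j₂ : Fin m) → PairOrEmpty (twiceAt i j₁ j₂)
twiceAt-pairOrEmpty i j₁ j₂ with ⌊ j₁ ≟ j₂ ⌋
... | true  = inj₁ refl
... | false = inj₂ (_ , _ , refl)

sizes-pairOrEmpty : ∀ {L} → PairOrEmpty L → sizes L ≤ 3
sizes-pairOrEmpty (inj₁ refl)           = z≤n
sizes-pairOrEmpty (inj₂ (_ , _ , refl)) = ≤-refl

depths-pairOrEmpty : ∀ {L} → PairOrEmpty L → depths L ≤ 1
depths-pairOrEmpty (inj₁ refl)           = z≤n
depths-pairOrEmpty (inj₂ (_ , _ , refl)) = ≤-refl

module _ {n m} (G : Graph n) (H : Graph m) where

  badEdgeAt : Fin n → Fin n → Fin m → Fin m → List Form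
  badEdgeAt i₁ i₂ j₁ j₂ =
    if adj G i₁ i₂ then (if adj H j₁ j₂ then [] else (pos (p i₁ j₁) ∧₂ pos (p i₂ j₂) ∷ [])) else []

  badEdgeFrom : Fin n → Fin n → Fin m → List Form
  badEdgeFrom i₁ i₂ j₁ = concatMap (badEdgeAt i₁ i₂ j₁) (allFin m)

  badEdgeOn : Fin n → Fin n → List Form
  badEdgeOn i₁ i₂ = concatMap (badEdgeFrom i₁ i₂) (allFin m)

  badEdgeOf : Fin n → List Form
  badEdgeOf i₁ = concatMap (badEdgeOn i₁) (allFin n)

  badEdge : List Form
  badEdge = concatMap badEdgeOf (allFin n)

  -- τ G H is definitionally ⋁ τParts
  τParts : List Form
  τParts = ⋁ (nowhere n m) ∷ ⋁ (twice n m) ∷ ⋁ badEdge ∷ []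

  ∈-badEdge : ∀ i₁ i₂ j₁ j₂ → adj G i₁ i₂ ≡ true → adj H j₁ j₂ ≡ false →
              (pos (p i₁ j₁) ∧₂ pos (p i₂ j₂)) ∈ badEdge
  ∈-badEdge i₁ i₂ j₁ j₂ eG eH = ∈-concatMap badEdgeOf (∈-concatMap (badEdgeOn i₁)
    (∈-concatMap (badEdgeFrom i₁ i₂) (∈-concatMap (badEdgeAt i₁ i₂ j₁) here′
      (∈-allFin j₂)) (∈-allFin j₁)) (∈-allFin i₂)) (∈-allFin i₁)
    where
    here′ : (pos (p i₁ j₁) ∧₂ pos (p i₂ j₂)) ∈ badEdgeAt i₁ i₂ j₁ j₂
    here′ rewrite eG | eH = here refl

  badEdgeAt-pairOrEmpty : ∀ i₁ i₂ j₁ j₂ → PairOrEmpty (badEdgeAt i₁ i₂ j₁ j₂)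
  badEdgeAt-pairOrEmpty i₁ i₂ j₁ j₂ with adj G i₁ i₂ | adj H j₁ j₂
  ... | true  | true  = inj₁ refl
  ... | true  | false = inj₂ (_ , _ , refl)
  ... | false | _     = inj₁ refl

-- The proof of τ_{G,H} for a non-bipartite G and a bipartite H with proper
-- colouring cH.  All lines are sequents of at most five formulas of size at most
-- N^10 and depth at most 3, where N = 2 + n + m; line counts are bounded by powers of N.
module Construction {n m : ℕ} (G : Graph n) (H : Graph m) (cH : Fin m → Bool)
                    (cH-proper : ∀ j j′ → adj H j j′ ≡ true → cH j ≢ cH j′) where

  N : ℕ
  N = 2 + n + m

  -- the base is passed as 2 + n + m rather than N: comparing N ^ 35 with (2 + n + m) ^ 35
  -- in the final bound would make the type checker unfold the powers
  open Powers (2 + n + m) (s≤s (s≤s z≤n))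

  n≤N : n ≤ N
  n≤N = ≤-trans (m≤m+n n m) (≤-trans (n≤1+n _) (n≤1+n _))

  suc-m≤N : suc m ≤ N
  suc-m≤N = s≤s (≤-trans (m≤n+m m n) (n≤1+n _))

  m≤N : m ≤ N
  m≤N = ≤-trans (n≤1+n m) suc-m≤N

  W : ℕ
  W = pw 13

  open Derivations 3 W

  T : Form
  T = τ G H

  record Small (A : Form) : Set where
    constructor small
    field
      size≤  : size A ≤ pw 10
      depth≤ : depth A ≤ 3

  -- five small formulas have size at most 5 · N^10 ≤ N^13
  line : ∀ {Δ} → All Small Δ → {True (length Δ ≤? 5)} → Line Δ
  line {Δ} smalls {≤5} = ≤-trans (sizes≤ smalls) (*-≤pw {e = 3} (≤pw 3 (≤-trans (toWitness ≤5) 5≤8)) ≤-refl) ,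
                         depths≤ smalls
    where
    5≤8 : 5 ≤ 8
    5≤8 = m≤m+n 5 3
    sizes≤ : ∀ {Δ} → All Small Δ → sizes Δ ≤ length Δ * pw 10
    sizes≤ []                  = z≤n
    sizes≤ (small s≤ _ ∷ smalls) = +-mono-≤ s≤ (sizes≤ smalls)
    depths≤ : ∀ {Δ} → All Small Δ → depths Δ ≤ 3
    depths≤ []                  = z≤n
    depths≤ (small _ d≤ ∷ smalls) = ⊔-lub d≤ (depths≤ smalls)

  sizes-block : ∀ {k} (f : Fin k → List Form) {e} → k ≤ N → (∀ x → sizes (f x) ≤ pw e) →
                sizes (concatMap f (allFin k)) ≤ pw (suc e)
  sizes-block {k} f {e} k≤N f≤ = ≤-trans (sizes-concatMap f f≤ (allFin k))
    (subst (λ l → l * pw e ≤ pw (suc e)) (sym (length-allFin k)) (*N-≤pw k≤N ≤-refl))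

  pair≤ : ∀ {L} → PairOrEmpty L → sizes L ≤ pw 2
  pair≤ po = ≤pw 2 (≤-trans (sizes-pairOrEmpty po) (n≤1+n 3))

  size-overH : (f : Fin m → Form) → (∀ j → size (f j) ≤ 1) → suc (sizes (map f (allFin m))) ≤ N
  size-overH f f≤1 = ≤-trans (s≤s (sizes-map f f≤1 (allFin m)))
    (subst (λ l → suc (l * 1) ≤ N) (sym (length-allFin m)) (subst (λ l → suc l ≤ N) (sym (*-identityʳ m)) suc-m≤N))

  size-nowhereAt : ∀ (i : Fin n) → size (nowhereAt m i) ≤ N
  size-nowhereAt i = size-overH (λ j → neg (p i j)) (λ _ → ≤-refl)

  size-nowhere : size (⋁ (nowhere n m)) ≤ pw 3
  size-nowhere = suc-≤pw (≤-trans (sizes-map (nowhereAt {n} m) size-nowhereAt (allFin n))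
    (subst (λ l → l * N ≤ pw 2) (sym (length-allFin n)) (*N-≤pw n≤N N≤pw1)))

  depth-nowhere : depth (⋁ (nowhere n m)) ≤ 2
  depth-nowhere = s≤s (depths-map (nowhereAt {n} m) (λ i → s≤s (depths-map _ (λ _ → z≤n) (allFin m))) (allFin n))

  size-twice : size (⋁ (twice n m)) ≤ pw 6
  size-twice = suc-≤pw (sizes-block (twiceOf m) n≤N λ i → sizes-block (twiceFrom m i) m≤N λ j₁ →
    sizes-block (twiceAt i j₁) m≤N λ j₂ → pair≤ (twiceAt-pairOrEmpty i j₁ j₂))

  depth-twice : depth (⋁ (twice n m)) ≤ 2
  depth-twice = s≤s (depths-concatMap (twiceOf m) (λ i → depths-concatMap (twiceFrom m i) (λ j₁ →
    depths-concatMap (twiceAt i j₁) (λ j₂ → depths-pairOrEmpty (twiceAt-pairOrEmpty i j₁ j₂))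
      (allFin m)) (allFin m)) (allFin n))

  size-badEdge : size (⋁ (badEdge G H)) ≤ pw 7
  size-badEdge = suc-≤pw (sizes-block (badEdgeOf G H) n≤N λ i₁ → sizes-block (badEdgeOn G H i₁) n≤N λ i₂ →
    sizes-block (badEdgeFrom G H i₁ i₂) m≤N λ j₁ → sizes-block (badEdgeAt G H i₁ i₂ j₁) m≤N λ j₂ →
      pair≤ (badEdgeAt-pairOrEmpty G H i₁ i₂ j₁ j₂))

  depth-badEdge : depth (⋁ (badEdge G H)) ≤ 2
  depth-badEdge = s≤s (depths-concatMap (badEdgeOf G H) (λ i₁ → depths-concatMap (badEdgeOn G H i₁) (λ i₂ →
    depths-concatMap (badEdgeFrom G H i₁ i₂) (λ j₁ → depths-concatMap (badEdgeAt G H i₁ i₂ j₁) (λ j₂ →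
      depths-pairOrEmpty (badEdgeAt-pairOrEmpty G H i₁ i₂ j₁ j₂)) (allFin m)) (allFin m)) (allFin n)) (allFin n))

  small-nowhere : Small (⋁ (nowhere n m))
  small-nowhere = small (≤pw-mono (m≤m+n 3 7) size-nowhere) (≤-trans depth-nowhere (n≤1+n 2))

  small-twice : Small (⋁ (twice n m))
  small-twice = small (≤pw-mono (m≤m+n 6 4) size-twice) (≤-trans depth-twice (n≤1+n 2))

  small-badEdge : Small (⋁ (badEdge G H))
  small-badEdge = small (≤pw-mono (m≤m+n 7 3) size-badEdge)
                        (≤-trans depth-badEdge (n≤1+n 2))

  small-T : Small T
  small-T = small
    (suc-≤pw (+-≤pw (≤pw-mono (m≤m+n 3 5) size-nowhere)
                    (+-≤pw (≤pw-mono (n≤1+n 6) size-twice) (≤-trans (≤-reflexive (+-identityʳ _)) size-badEdge))))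
    (s≤s (⊔-lub depth-nowhere (⊔-lub depth-twice (⊔-lub depth-badEdge z≤n))))

  ifSame : Bool → Bool → Form → Form
  ifSame true  true  A = A
  ifSame false false A = A
  ifSame true  false A = ⋁ []
  ifSame false true  A = ⋁ []

  ifSame-refl : ∀ c A → ifSame c c A ≡ A
  ifSame-refl true  A = refl
  ifSame-refl false A = refl

  size-ifSame : ∀ b c x → size (ifSame b c (pos x)) ≤ 1
  size-ifSame true  true  x = ≤-refl
  size-ifSame false false x = ≤-refl
  size-ifSame true  false x = ≤-refl
  size-ifSame false true  x = ≤-refl

  depth-ifSame : ∀ b c x → depth (ifSame b c (pos x)) ≤ 1
  depth-ifSame true  true  x = z≤n
  depth-ifSame false false x = z≤n
  depth-ifSame true  false x = ≤-refl
  depth-ifSame false true  x = ≤-refl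

  intoAt : Fin n → Bool → Fin m → Form
  intoAt v c j = ifSame (cH j) c (pos (p v j))

  Into : Fin n → Bool → Form
  Into v c = ⋁ (map (intoAt v c) (allFin m))

  NotInto : Fin n → Bool → Form
  NotInto v c = dual (Into v c)

  ∈-Into : ∀ v c j → cH j ≡ c → pos (p v j) ∈ map (intoAt v c) (allFin m)
  ∈-Into v c j cHj≡c = subst (_∈ map (intoAt v c) (allFin m))
    (trans (cong (λ b → ifSame b c (pos (p v j))) cHj≡c) (ifSame-refl c _)) (∈-map⁺ (intoAt v c) (∈-allFin j))

  small-pos : ∀ x → Small (pos x)
  small-pos x = small (1≤pw 10) z≤n

  small-neg : ∀ x → Small (neg x)
  small-neg x = small (1≤pw 10) z≤n

  small-⊤ : Small (⋀ [])
  small-⊤ = small (1≤pw 10) (s≤s z≤n)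

  small-pair : ∀ x y → Small (pos x ∧₂ pos y)
  small-pair x y = small (≤pw 10 (m≤m+n 3 1021)) (s≤s z≤n)

  small-nowhereAt : ∀ (i : Fin n) → Small (nowhereAt m i)
  small-nowhereAt i = small (≤pw-mono (m≤m+n 1 9) (≤-trans (size-overH _ (λ _ → ≤-refl)) N≤pw1))
                            (s≤s (depths-map _ (λ _ → z≤n) (allFin m)))

  small-Into : ∀ v c → Small (Into v c)
  small-Into v c = small
    (≤pw-mono (m≤m+n 1 9) (≤-trans (size-overH (intoAt v c) (λ j → size-ifSame (cH j) c _)) N≤pw1))
    (s≤s (≤-trans (depths-map (intoAt v c) (λ j → depth-ifSame (cH j) c _) (allFin m)) (n≤1+n 1)))

  small-dual : ∀ {A} → Small A → Small (dual A)
  small-dual {A} (small s≤ d≤) = small (subst (_≤ pw 10) (sym (size-dual A)) s≤) (subst (_≤ 3) (sym (depth-dual A)) d≤)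

  small-NotInto : ∀ v c → Small (NotInto v c)
  small-NotInto v c = small-dual (small-Into v c)

  ax : ∀ {Δ} x → pos x ∈ Δ → neg x ∈ Δ → Line Δ → Deriv (pw 0) Δ
  ax x pos∈ neg∈ ℓ = relax (1≤pw 0) (rule₀ ℓ (axiom x pos∈ neg∈))

  weaken : ∀ {k Γ Δ} → Line Δ → Deriv k Γ → All (_∈ Δ) Γ → Deriv (suc k) Δ
  weaken ℓ d Γ⊆Δ = rule₁ ℓ d (λ Γ∈ → weak Γ∈ (All.lookup Γ⊆Δ))

  weakenᴺ : ∀ e {Γ Δ} → Line Δ → Deriv (pw e) Γ → All (_∈ Δ) Γ → Deriv (pw (suc e)) Δ
  weakenᴺ e ℓ d Γ⊆Δ = relax (suc-≤pw ≤-refl) (weaken ℓ d Γ⊆Δ)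

  orᴺ : ∀ e {A Γ} As → A ∈ As → Line (⋁ As ∷ Γ) → Deriv (pw e) (A ∷ Γ) → Deriv (pw (suc e)) (⋁ As ∷ Γ)
  orᴺ e As A∈ ℓ d = relax (suc-≤pw ≤-refl) (rule₁ ℓ d (orI As A∈))

  cut′ : ∀ {k₁ k₂ Δ} A → Line Δ → Deriv k₁ (A ∷ Δ) → Deriv k₂ (dual A ∷ Δ) → Deriv (suc (k₁ + k₂)) Δ
  cut′ A ℓ d₁ d₂ = rule₂ ℓ d₁ d₂ (cut A)

  cutᴺ : ∀ e {Δ} A → Line Δ → Deriv (pw e) (A ∷ Δ) → Deriv (pw e) (dual A ∷ Δ) → Deriv (pw (suc (suc e))) Δ
  cutᴺ e A ℓ d₁ d₂ = relax (suc-≤pw (+-≤pw ≤-refl ≤-refl)) (cut′ A ℓ d₁ d₂)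

  ∈0 : ∀ {A : Set} {x : A} {xs} → x ∈ (x ∷ xs)
  ∈0 = here refl
  ∈1 : ∀ {A : Set} {x y : A} {xs} → x ∈ (y ∷ x ∷ xs)
  ∈1 = there ∈0
  ∈2 : ∀ {A : Set} {x y z : A} {xs} → x ∈ (y ∷ z ∷ x ∷ xs)
  ∈2 = there ∈1
  ∈3 : ∀ {A : Set} {x y z w : A} {xs} → x ∈ (y ∷ z ∷ w ∷ x ∷ xs)
  ∈3 = there ∈2

  refuteIfSame : ∀ {k Γ} b c (A : Form) → 1 ≤ k → Line (⋀ [] ∷ Γ) → (b ≡ c → Deriv k (dual A ∷ Γ)) →
                 Deriv k (dual (ifSame b c A) ∷ Γ)
  refuteIfSame true  true  A 1≤k ℓ d = d refl
  refuteIfSame false false A 1≤k ℓ d = d refl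
  refuteIfSame true  false A 1≤k ℓ d = relax 1≤k (rule₀ ℓ (andI [] []))
  refuteIfSame false true  A 1≤k ℓ d = relax 1≤k (rule₀ ℓ (andI [] []))

  refuteInto : ∀ e {Γ} v c → Line (NotInto v c ∷ Γ) → Line (⋀ [] ∷ Γ) →
               (∀ j → cH j ≡ c → Deriv (pw e) (neg (p v j) ∷ Γ)) → Deriv (pw (suc e)) (NotInto v c ∷ Γ)
  refuteInto e {Γ} v c ℓ ℓ⊤ d =
    relax (subst (λ l → suc (l * pw e) ≤ pw (suc e)) (sym length-conjuncts) (suc-*-≤pw suc-m≤N ≤-refl))
      (ruleAnd conjuncts ℓ premises)
    where
    conjuncts : List Form
    conjuncts = duals (map (intoAt v c) (allFin m))
    premises : All (λ A → Deriv (pw e) (A ∷ Γ)) conjuncts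
    premises = subst (All (λ A → Deriv (pw e) (A ∷ Γ))) (sym (duals-map (intoAt v c) (allFin m)))
      (map⁺ (tabulate⁺ (λ j → refuteIfSame (cH j) c (pos (p v j)) (1≤pw e) ℓ⊤ (d j))))
    length-conjuncts : length conjuncts ≡ m
    length-conjuncts = trans (cong length (duals-map (intoAt v c) (allFin m)))
                             (trans (length-map _ (allFin m)) (length-allFin m))

  identity : ∀ i s → Deriv (pw 3) (NotInto i s ∷ Into i s ∷ T ∷ [])
  identity i s =
    refuteInto 2 i s (line (small-NotInto i s ∷ small-Into i s ∷ small-T ∷ []))
                     (line (small-⊤ ∷ small-Into i s ∷ small-T ∷ [])) λ j cHj≡s →
      let x = p i j in
      weakenᴺ 1 (line (small-neg x ∷ small-Into i s ∷ small-T ∷ []))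
        (orᴺ 0 (map (intoAt i s) (allFin m)) (∈-Into i s j cHj≡s) (line (small-Into i s ∷ small-neg x ∷ small-T ∷ []))
          (ax x ∈0 ∈1 (line (small-pos x ∷ small-neg x ∷ small-T ∷ []))))
        (∈1 ∷ ∈0 ∷ ∈2 ∷ [])

  -- ⊢ Into w true, Into w false, τ : unless w is mapped nowhere (first part of τ),
  -- w is mapped to some j, whose colour is true or false
  somewhere : ∀ w → Deriv (pw 6) (Into w true ∷ Into w false ∷ T ∷ [])
  somewhere w =
    weakenᴺ 5 (line (small-Into w true ∷ small-Into w false ∷ small-T ∷ []))
      (orᴺ 4 (τParts G H) ∈0 (line (small-T ∷ small-Into w true ∷ small-Into w false ∷ small-T ∷ []))
        (orᴺ 3 (nowhere n m) (∈-map⁺ (nowhereAt m) (∈-allFin w))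
               (line (small-nowhere ∷ small-Into w true ∷ small-Into w false ∷ small-T ∷ []))
          (relax (subst (λ l → suc (l * pw 2) ≤ pw 3) (sym length-negs) (suc-*-≤pw suc-m≤N ≤-refl))
            (ruleAnd (map (λ j → neg (p w j)) (allFin m))
              (line (small-nowhereAt w ∷ small-Into w true ∷ small-Into w false ∷ small-T ∷ []))
              (map⁺ (tabulate⁺ mappedTo))))))
      (∈2 ∷ ∈0 ∷ ∈1 ∷ ∈2 ∷ [])
    where
    length-negs : length (map (λ j → neg (p w j)) (allFin m)) ≡ m
    length-negs = trans (length-map _ (allFin m)) (length-allFin m)
    mappedTo : ∀ j → Deriv (pw 2) (neg (p w j) ∷ Into w true ∷ Into w false ∷ T ∷ [])
    mappedTo j with cH j in cHj
    ... | true = weakenᴺ 1 (line (small-neg x ∷ small-Into w true ∷ small-Into w false ∷ small-T ∷ []))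
          (orᴺ 0 (map (intoAt w true) (allFin m)) (∈-Into w true j cHj)
                 (line (small-Into w true ∷ small-neg x ∷ small-Into w false ∷ small-T ∷ []))
            (ax x ∈0 ∈1 (line (small-pos x ∷ small-neg x ∷ small-Into w false ∷ small-T ∷ []))))
          (∈1 ∷ ∈0 ∷ ∈2 ∷ ∈3 ∷ [])
      where x = p w j
    ... | false = weakenᴺ 1 (line (small-neg x ∷ small-Into w true ∷ small-Into w false ∷ small-T ∷ []))
          (orᴺ 0 (map (intoAt w false) (allFin m)) (∈-Into w false j cHj)
                 (line (small-Into w false ∷ small-neg x ∷ small-Into w true ∷ small-T ∷ []))
            (ax x ∈0 ∈1 (line (small-pos x ∷ small-neg x ∷ small-Into w true ∷ small-T ∷ []))))
          (∈2 ∷ ∈0 ∷ ∈1 ∷ ∈3 ∷ [])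
      where x = p w j

  forbiddenPair : ∀ (L : List Form) → ⋁ L ∈ τParts G H → Small (⋁ L) → ∀ v w c c′ →
    (∀ j j′ → cH j ≡ c → cH j′ ≡ c′ → (pos (p v j) ∧₂ pos (p w j′)) ∈ L) →
    Deriv (pw 8) (NotInto v c ∷ NotInto w c′ ∷ T ∷ [])
  forbiddenPair L L∈τ small-L v w c c′ pair∈L =
    refuteInto 7 v c (line (small-NotInto v c ∷ small-NotInto w c′ ∷ small-T ∷ []))
                     (line (small-⊤ ∷ small-NotInto w c′ ∷ small-T ∷ [])) λ j cHj≡c →
      weakenᴺ 6 (line (small-neg (p v j) ∷ small-NotInto w c′ ∷ small-T ∷ []))
        (refuteInto 5 w c′ (line (small-NotInto w c′ ∷ small-neg (p v j) ∷ small-T ∷ []))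
                           (line (small-⊤ ∷ small-neg (p v j) ∷ small-T ∷ []))
          (λ j′ cHj′≡c′ → pair j j′ cHj≡c cHj′≡c′))
        (∈1 ∷ ∈0 ∷ ∈2 ∷ [])
    where
    pair : ∀ j j′ → cH j ≡ c → cH j′ ≡ c′ → Deriv (pw 5) (neg (p w j′) ∷ neg (p v j) ∷ T ∷ [])
    pair j j′ cHj≡c cHj′≡c′ =
      weakenᴺ 4 (line (small-neg y ∷ small-neg x ∷ small-T ∷ []))
        (orᴺ 3 (τParts G H) L∈τ (line (small-T ∷ small-neg y ∷ small-neg x ∷ []))
          (orᴺ 2 L (pair∈L j j′ cHj≡c cHj′≡c′) (line (small-L ∷ small-neg y ∷ small-neg x ∷ []))
            (relax (≤pw 2 (s≤s (s≤s (s≤s z≤n))))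
              (ruleAnd (pos x ∷ pos y ∷ []) (line (small-pair x y ∷ small-neg y ∷ small-neg x ∷ []))
                (rule₀ (line (small-pos x ∷ small-neg y ∷ small-neg x ∷ [])) (axiom x ∈0 ∈2) ∷
                 rule₀ (line (small-pos y ∷ small-neg y ∷ small-neg x ∷ [])) (axiom y ∈0 ∈1) ∷ [])))))
        (∈2 ∷ ∈0 ∷ ∈1 ∷ [])
      where
      x = p v j
      y = p w j′

  -- ⊢ ¬Into v c, ¬Into w c, τ for an edge {v,w} of G: a colour class of H spans no edge,
  -- so the third part of τ applies
  edgeSplits : ∀ v w c → adj G v w ≡ true → Deriv (pw 8) (NotInto v c ∷ NotInto w c ∷ T ∷ [])
  edgeSplits v w c vw = forbiddenPair (badEdge G H) ∈2 small-badEdge v w c c pair∈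
    where
    pair∈ : ∀ j j′ → cH j ≡ c → cH j′ ≡ c → (pos (p v j) ∧₂ pos (p w j′)) ∈ badEdge G H
    pair∈ j j′ cHj≡c cHj′≡c with adj H j j′ in jj′
    ... | true  = ⊥-elim (cH-proper j j′ jj′ (trans cHj≡c (sym cHj′≡c)))
    ... | false = ∈-badEdge G H v w j j′ vw jj′

  -- ⊢ ¬Into i true, ¬Into i false, τ : otherwise the second part of τ applies
  notBoth : ∀ i → Deriv (pw 8) (NotInto i true ∷ NotInto i false ∷ T ∷ [])
  notBoth i = forbiddenPair (twice n m) ∈1 small-twice i i true false
    (λ j j′ cHj cHj′ → ∈-twice i j j′ (λ j≡j′ → true≢false (trans (sym cHj) (trans (cong cH j≡j′) cHj′))))
    where
    true≢false : true ≢ false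
    true≢false ()

  -- the number of lines one propagation step adds
  S : ℕ
  S = suc (pw 7 + suc (suc (suc (pw 9))))

  S≤ : S ≤ pw 14
  S≤ = suc-≤pw (+-≤pw (pw-mono (m≤m+n 7 5)) (suc-≤pw (suc-≤pw (suc-≤pw ≤-refl))))

  module Propagation (i : Fin n) (s : Bool) where

    X : Form
    X = NotInto i s

    small-X : Small X
    small-X = small-NotInto i s

    -- from ⊢ X, Into v c, τ and an edge {v,w} infer ⊢ X, Into w (not c), τ,
    -- cutting with 'edgeSplits v w c' and 'somewhere w'
    alternate : ∀ {k} v w c → adj G v w ≡ true → Deriv k (X ∷ Into v c ∷ T ∷ []) →
                Deriv (k + S) (X ∷ Into w (not c) ∷ T ∷ [])
    alternate {k} v w c vw d = relax (≤-reflexive (count (pw 7) (pw 9) k)) cut-w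
      where
      -- ⊢ X, ¬Into w c, τ : since v is in class c, w is not
      cut-v : Deriv (suc (suc k + pw 9)) (X ∷ NotInto w c ∷ T ∷ [])
      cut-v = cut′ (Into v c) (line (small-X ∷ small-NotInto w c ∷ small-T ∷ []))
        (weaken (line (small-Into v c ∷ small-X ∷ small-NotInto w c ∷ small-T ∷ [])) d (∈1 ∷ ∈0 ∷ ∈3 ∷ []))
        (weakenᴺ 8 (line (small-NotInto v c ∷ small-X ∷ small-NotInto w c ∷ small-T ∷ []))
          (edgeSplits v w c vw) (∈0 ∷ ∈2 ∷ ∈3 ∷ []))
      -- ⊢ Into w c, X, Into w (not c), τ : w is in one of the two classes
      somewhere-w : Deriv (pw 7) (Into w c ∷ X ∷ Into w (not c) ∷ T ∷ [])
      somewhere-w = weakenᴺ 6 (line (small-Into w c ∷ small-X ∷ small-Into w (not c) ∷ small-T ∷ []))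
        (somewhere w) (reorder c)
        where
        reorder : ∀ c → All (_∈ (Into w c ∷ X ∷ Into w (not c) ∷ T ∷ [])) (Into w true ∷ Into w false ∷ T ∷ [])
        reorder true  = ∈0 ∷ ∈2 ∷ ∈3 ∷ []
        reorder false = ∈2 ∷ ∈0 ∷ ∈3 ∷ []
      cut-w : Deriv (suc (pw 7 + suc (suc (suc k + pw 9)))) (X ∷ Into w (not c) ∷ T ∷ [])
      cut-w = cut′ (Into w c) (line (small-X ∷ small-Into w (not c) ∷ small-T ∷ [])) somewhere-w
        (weaken (line (small-NotInto w c ∷ small-X ∷ small-Into w (not c) ∷ small-T ∷ [])) cut-v (∈1 ∷ ∈0 ∷ ∈3 ∷ []))
      count : ∀ a b k → suc (a + suc (suc (suc (k + b)))) ≡ k + suc (a + suc (suc (suc b)))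
      count = solve-∀

    open OddWalks G using (Walk; stop; step; len)

    alongWalk : ∀ {k v b y} (ω : Walk (v , b) y) → Deriv k (X ∷ Into v (b xor s) ∷ T ∷ []) →
                Deriv (k + len ω * S) (X ∷ Into (proj₁ y) (proj₂ y xor s) ∷ T ∷ [])
    alongWalk {k} stop d = relax (m≤m+n k 0) d
    alongWalk {k} {v} {b} (step {y = w , _} (vw , refl) ω) d =
      relax (≤-reflexive (+-assoc k S (len ω * S))) (alongWalk ω d′)
      where
      d′ : Deriv (k + S) (X ∷ Into w (not b xor s) ∷ T ∷ [])
      d′ = subst (λ c → Deriv (k + S) (X ∷ Into w c ∷ T ∷ [])) (not-distribˡ-xor b s) (alternate v w (b xor s) vw d)

    swap : (ω : Walk (i , false) (i , true)) → len ω ≤ n + n → Deriv (pw 17) (NotInto i s ∷ Into i (not s) ∷ T ∷ [])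
    swap ω ω≤2n = relax budget (alongWalk ω (identity i s))
      where
      budget : pw 3 + len ω * S ≤ pw 17
      budget = +-≤pw (pw-mono (m≤m+n 3 13))
                     (*-≤pw {e = 2} (≤-trans ω≤2n (+-≤pw (≤-trans n≤N N≤pw1) (≤-trans n≤N N≤pw1))) S≤)

  refutation : ∀ i (ω : OddWalks.Walk G (i , false) (i , true)) → OddWalks.len G ω ≤ n + n →
               Deriv (pw 22) (T ∷ [])
  refutation i ω ω≤2n = cutᴺ 20 (Into i true) (line (small-T ∷ [])) into-true not-into-true
    where
    open Propagation using (swap)
    not-into-true : Deriv (pw 20) (NotInto i true ∷ T ∷ [])
    not-into-true = cutᴺ 18 (Into i false) (line (small-NotInto i true ∷ small-T ∷ []))
      (weakenᴺ 17 (line (small-Into i false ∷ small-NotInto i true ∷ small-T ∷ [])) (swap i true ω ω≤2n)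
        (∈1 ∷ ∈0 ∷ ∈2 ∷ []))
      (weakenᴺ 17 (line (small-NotInto i false ∷ small-NotInto i true ∷ small-T ∷ []))
        (relax (pw-mono (m≤m+n 8 9)) (notBoth i)) (∈1 ∷ ∈0 ∷ ∈2 ∷ []))
    into-true : Deriv (pw 20) (Into i true ∷ T ∷ [])
    into-true = cutᴺ 18 (Into i false) (line (small-Into i true ∷ small-T ∷ []))
      (weakenᴺ 17 (line (small-Into i false ∷ small-Into i true ∷ small-T ∷ []))
        (relax (pw-mono (m≤m+n 6 11)) (somewhere i)) (∈1 ∷ ∈0 ∷ ∈2 ∷ []))
      (weakenᴺ 17 (line (small-NotInto i false ∷ small-Into i true ∷ small-T ∷ [])) (swap i false ω ω≤2n)
        (∈0 ∷ ∈1 ∷ ∈2 ∷ []))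

  -- the resulting depth-3 proof of τ has size at most N^22 · N^13 = N^35
  proofOfτ : ∀ i (ω : OddWalks.Walk G (i , false) (i , true)) → OddWalks.len G ω ≤ n + n →
             ProofOf T 3 ((2 + n + m) ^ 35)
  proofOfτ i ω ω≤2n = toProof (refutation i ω ω≤2n) (≤-trans (*-≤pw ≤-refl ≤-refl) (≤-reflexive (pw-≡ 35)))

theorem4 : ∃[ d ] ∃[ k ] (∀ (n m : ℕ) (G : Graph n) (H : Graph m) → ¬ Bipartite G → Bipartite H → ProofOf (τ G H) d ((2 + n + m) ^ k))
theorem4 = 3 , 35 , λ n m G H ¬bipartiteG (cH , cH-proper) →
  let (i , ω , ω≤2n) = OddWalks.oddClosedWalk G ¬bipartiteG
  in  Construction.proofOfτ G H cH cH-proper i ω ω≤2n
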